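{- Let $k\geq 4$ and let $G$ be a graph with vertex partition $V_1,V_2,\dots,V_k$, with $|V_i|=n_i\geq 1$, and let $d_{i,j}=d_{j,i}\in[0,1]$ be the edge density between $V_i$ and $V_j$. Then the number of transversal cliques in $G$ is at most \[ n_1n_2\cdots n_k\prod_{i=1}^{k}\sqrt{d_{i,i+1}} + o(n_1n_2\cdots n_k), \] where indices are taken modulo $k$ (so $d_{k,k+1}=d_{k,1}$).
   Context: The edge density between $V_i$ and $V_j$ is $e(V_i,V_j)/(|V_i||V_j|)$. A transversal clique is a set consisting of exactly one vertex from each $V_i$ that induces a complete graph. The $o(n_1\cdots n_k)$ term is with respect to all $n_i\to\infty$ with $k$ and the densities fixed. -}

module Defs where

open import Data.Nat as ℕ using (ℕ; zero; suc)
open import Data.Nat.DivMod using (_mod_)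
open import Data.Fin using (Fin; toℕ; _≟_)
open import Data.List using (List; []; _∷_; concatMap; map; filter; length; foldr)
open import Data.Fin.Base using () renaming (zero to fzero; suc to fsuc)
open import Data.Bool using (Bool; true; false; _∨_; _∧_; if_then_else_)
open import Data.Product using (Σ; _,_)
open import Data.Integer using (+_)
open import Data.Rational using (ℚ; _/_; _*_; 1ℚ)
open import Relation.Nullary using (does)
open import Relation.Binary.PropositionalEquality using (_≡_)

allFin : (n : ℕ) → List (Fin n)
allFin zero = []
allFin (suc n) = fzero ∷ map fsuc (allFin n)

Vtx : (k : ℕ) → (Fin k → ℕ) → Set
Vtx k n = Σ (Fin k) (λ i → Fin (n i))

record Graph (k : ℕ) (n : Fin k → ℕ) : Set where
  field
    adj    : Vtx k n → Vtx k n → Bool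
    sym    : ∀ u v → adj u v ≡ adj v u
    irrefl : ∀ v → adj v v ≡ false
open Graph public

sumℕ : List ℕ → ℕ
sumℕ = foldr ℕ._+_ 0

prodℚ : List ℚ → ℚ
prodℚ = foldr _*_ 1ℚ

prodℕ : List ℕ → ℕ
prodℕ = foldr ℕ._*_ 1

edges : ∀ {k n} → Graph k n → Fin k → Fin k → ℕ
edges {k} {n} G i j =
  sumℕ (map (λ a → sumℕ (map (λ b → if adj G (i , a) (j , b) then 1 else 0)
                              (allFin (n j))))
            (allFin (n i)))

transversals : (k : ℕ) (n : Fin k → ℕ) → List ((i : Fin k) → Fin (n i))
transversals zero n = (λ ()) ∷ []
transversals (suc k) n =
  concatMap (λ a → map (λ f → cons a f) (transversals k (λ i → n (fsuc i))))
            (allFin (n fzero))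
  where
  cons : Fin (n fzero) → ((i : Fin k) → Fin (n (fsuc i))) → (i : Fin (suc k)) → Fin (n i)
  cons a f fzero = a
  cons a f (fsuc i) = f i

allB : {A : Set} → (A → Bool) → List A → Bool
allB p [] = true
allB p (x ∷ xs) = p x ∧ allB p xs

isCliqueB : ∀ {k n} → Graph k n → ((i : Fin k) → Fin (n i)) → Bool
isCliqueB {k} G f =
  allB (λ i → allB (λ j → does (i ≟ j) ∨ adj G (i , f i) (j , f j)) (allFin k)) (allFin k)

transversalCliques : ∀ {k n} → Graph k n → ℕ
transversalCliques {k} {n} G = length (filter (λ f → isCliqueB G f ≟b true) (transversals k n))
  where
  open import Data.Bool.Properties using () renaming (_≟_ to _≟b_)

next : ∀ {k} → Fin k → Fin k
next {suc m} i = suc (toℕ i) mod suc m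

toℚ : ℕ → ℚ
toℚ m = + m / 1

-- Let A_i be the 0/1 biadjacency matrix of G between V_i and V_{i+1}. Every
-- transversal clique contributes 1 to tr(A_1 A_2 ⋯ A_k), the number of closed
-- walks that visit V_1, …, V_k in order. Cauchy–Schwarz gives tr(AB)² ≤ ‖A‖²‖B‖²
-- and ‖AB‖² ≤ ‖A‖²‖B‖² for the Frobenius norm, so tr(A_1 ⋯ A_k)² ≤ ∏ ‖A_i‖², and
-- ‖A_i‖² = e(V_i, V_{i+1}) = d_{i,i+1} n_i n_{i+1}. Hence the bound holds exactly,
-- with no error term, already for k ≥ 2, and N = 0 witnesses the statement.
module Submission where

open import Defs hiding (sym)
open import Data.Nat using (ℕ; zero; suc; _≤_; z≤n; s≤s)
open import Data.Fin using (Fin)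
open import Data.List using (List; []; _∷_; map)
open import Data.List.Properties using (map-cong)
open import Data.Product using (∃; _,_)
open import Data.Sum using (_⊎_; inj₁; inj₂)
open import Relation.Nullary using (yes; no)
open import Relation.Binary.PropositionalEquality
  using (_≡_; _≢_; refl; sym; trans; cong; cong₂; subst₂; module ≡-Reasoning)

module Counting where

  open import Data.Nat using (_+_; _*_)
  open import Data.Nat.Properties hiding (_≟_; suc-injective)
  open import Data.Nat.ListAction.Properties using (sum-++)
  open import Data.Nat.Tactic.RingSolver using (solve-∀)
  open import Data.Nat.DivMod using (_%_; m<n⇒m%n≡m; n%n≡0)
  open import Data.Fin using (toℕ; inject₁; fromℕ; _≟_) renaming (zero to fzero; suc to fsuc)
  open import Data.Fin.Properties using (toℕ-injective; toℕ-fromℕ<; toℕ-inject₁; toℕ<n; toℕ-fromℕ; suc-injective)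
  open import Data.List using (_++_; concatMap; length; filter)
  open import Data.List.Properties using (map-∘; map-++)
  open import Data.Bool using (Bool; true; false; _∧_; if_then_else_)
  open import Data.Bool.Properties using (∧-conicalˡ; ∧-conicalʳ)
  open import Data.Empty using (⊥-elim)
  open import Function using (_∘_)
  open import Level using (Level)
  open import Relation.Unary using (Pred; Decidable)
  open import Relation.Binary.PropositionalEquality using (subst)
  open import Algebra.Properties.CommutativeSemigroup +-commutativeSemigroup using (interchange)

  private variable
    A B : Set
    k m p q r : ℕ

  ∑ : List A → (A → ℕ) → ℕ
  ∑ xs f = sumℕ (map f xs)

  ∑-cong : (xs : List A) {f g : A → ℕ} → (∀ x → f x ≡ g x) → ∑ xs f ≡ ∑ xs g
  ∑-cong xs f≗g = cong sumℕ (map-cong f≗g xs)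

  ∑-mono : (xs : List A) {f g : A → ℕ} → (∀ x → f x ≤ g x) → ∑ xs f ≤ ∑ xs g
  ∑-mono []       f≤g = z≤n
  ∑-mono (x ∷ xs) f≤g = +-mono-≤ (f≤g x) (∑-mono xs f≤g)

  ∑-zero : (xs : List A) → ∑ xs (λ _ → 0) ≡ 0
  ∑-zero []       = refl
  ∑-zero (_ ∷ xs) = ∑-zero xs

  ∑-+ : (xs : List A) (f g : A → ℕ) → ∑ xs (λ x → f x + g x) ≡ ∑ xs f + ∑ xs g
  ∑-+ []       f g = refl
  ∑-+ (x ∷ xs) f g =
    trans (cong (f x + g x +_) (∑-+ xs f g)) (interchange (f x) (g x) (∑ xs f) (∑ xs g))

  ∑-*ˡ : (c : ℕ) (xs : List A) (f : A → ℕ) → ∑ xs (λ x → c * f x) ≡ c * ∑ xs f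
  ∑-*ˡ c []       f = sym (*-zeroʳ c)
  ∑-*ˡ c (x ∷ xs) f = trans (cong (c * f x +_) (∑-*ˡ c xs f)) (sym (*-distribˡ-+ c (f x) _))

  ∑-*ʳ : (c : ℕ) (xs : List A) (f : A → ℕ) → ∑ xs (λ x → f x * c) ≡ ∑ xs f * c
  ∑-*ʳ c []       f = refl
  ∑-*ʳ c (x ∷ xs) f = trans (cong (f x * c +_) (∑-*ʳ c xs f)) (sym (*-distribʳ-+ c (f x) _))

  ∑-comm : (xs : List A) (ys : List B) (h : A → B → ℕ) →
    ∑ xs (λ x → ∑ ys (h x)) ≡ ∑ ys (λ y → ∑ xs (λ x → h x y))
  ∑-comm []       ys h = sym (∑-zero ys)
  ∑-comm (x ∷ xs) ys h =
    trans (cong (∑ ys (h x) +_) (∑-comm xs ys h)) (sym (∑-+ ys (h x) (λ y → ∑ xs (λ x → h x y))))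

  ∑-*-∑ : (xs : List A) (ys : List B) (f : A → ℕ) (g : B → ℕ) →
    ∑ xs f * ∑ ys g ≡ ∑ xs (λ x → ∑ ys (λ y → f x * g y))
  ∑-*-∑ xs ys f g = trans (sym (∑-*ʳ (∑ ys g) xs f)) (∑-cong xs (λ x → sym (∑-*ˡ (f x) ys g)))

  ∑-map : (g : A → B) (xs : List A) (w : B → ℕ) → ∑ (map g xs) w ≡ ∑ xs (w ∘ g)
  ∑-map g xs w = cong sumℕ (sym (map-∘ xs))

  ∑-concatMap : (g : A → List B) (xs : List A) (w : B → ℕ) →
    ∑ (concatMap g xs) w ≡ ∑ xs (λ x → ∑ (g x) w)
  ∑-concatMap g []       w = refl
  ∑-concatMap g (x ∷ xs) w = begin
    sumℕ (map w (g x ++ concatMap g xs))         ≡⟨ cong sumℕ (map-++ w (g x) (concatMap g xs)) ⟩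
    sumℕ (map w (g x) ++ map w (concatMap g xs)) ≡⟨ sum-++ (map w (g x)) _ ⟩
    ∑ (g x) w + ∑ (concatMap g xs) w              ≡⟨ cong (∑ (g x) w +_) (∑-concatMap g xs w) ⟩
    ∑ (g x) w + ∑ xs (λ x → ∑ (g x) w)            ∎
    where open ≡-Reasoning

  private
    2*m*n≤m*m+n*n-ordered : m ≤ q → 2 * (m * q) ≤ m * m + q * q
    2*m*n≤m*m+n*n-ordered {m} m≤q with m≤n⇒∃[o]m+o≡n m≤q
    ... | d , refl = subst (2 * (m * (m + d)) ≤_) (square m d) (m≤m+n _ (d * d))
      where
      square : ∀ m d → 2 * (m * (m + d)) + d * d ≡ m * m + (m + d) * (m + d)
      square = solve-∀

  2*m*n≤m*m+n*n : ∀ m n → 2 * (m * n) ≤ m * m + n * n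
  2*m*n≤m*m+n*n m n with ≤-total m n
  ... | inj₁ m≤n = 2*m*n≤m*m+n*n-ordered m≤n
  ... | inj₂ n≤m =
    subst₂ _≤_ (cong (2 *_) (*-comm n m)) (+-comm (n * n) (m * m)) (2*m*n≤m*m+n*n-ordered n≤m)

  cauchy-schwarz : (xs : List A) (u v : A → ℕ) →
    ∑ xs (λ x → u x * v x) * ∑ xs (λ x → u x * v x) ≤ ∑ xs (λ x → u x * u x) * ∑ xs (λ x → v x * v x)
  cauchy-schwarz xs u v = *-cancelˡ-≤ 2 (begin
    2 * (∑ xs uv * ∑ xs uv)                                  ≡⟨ cong (2 *_) (∑-*-∑ xs xs uv uv) ⟩
    2 * ∑ xs (λ x → ∑ xs (λ y → uv x * uv y))                ≡⟨ sym (∑-*ˡ 2 xs _) ⟩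
    ∑ xs (λ x → 2 * ∑ xs (λ y → uv x * uv y))                ≡⟨ ∑-cong xs (λ x → sym (∑-*ˡ 2 xs _)) ⟩
    ∑ xs (λ x → ∑ xs (λ y → 2 * (uv x * uv y)))              ≤⟨ ∑-mono xs (λ x → ∑-mono xs (pairwise x)) ⟩
    ∑ xs (λ x → ∑ xs (λ y → uu x * vv y + uu y * vv x))      ≡⟨ ∑-cong xs (λ x → ∑-+ xs _ _) ⟩
    ∑ xs (λ x → ∑ xs (λ y → uu x * vv y) + ∑ xs (λ y → uu y * vv x))
                                                             ≡⟨ ∑-+ xs _ _ ⟩
    ∑ xs (λ x → ∑ xs (λ y → uu x * vv y)) + ∑ xs (λ x → ∑ xs (λ y → uu y * vv x))
                                                             ≡⟨ cong₂ _+_ (sym (∑-*-∑ xs xs uu vv))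
                                                                  (trans (∑-comm xs xs _) (sym (∑-*-∑ xs xs uu vv))) ⟩
    ∑ xs uu * ∑ xs vv + ∑ xs uu * ∑ xs vv                    ≡⟨ cong (∑ xs uu * ∑ xs vv +_) (sym (+-identityʳ _)) ⟩
    2 * (∑ xs uu * ∑ xs vv)                                  ∎)
    where
    open ≤-Reasoning
    uv uu vv : _ → ℕ
    uv x = u x * v x
    uu x = u x * u x
    vv x = v x * v x
    regroup : ∀ a b c d → 2 * ((a * b) * (c * d)) ≡ 2 * ((a * d) * (c * b))
    regroup = solve-∀
    regroup² : ∀ a b c d → (a * d) * (a * d) + (c * b) * (c * b) ≡ (a * a) * (d * d) + (c * c) * (b * b)
    regroup² = solve-∀
    pairwise : ∀ x y → 2 * (uv x * uv y) ≤ uu x * vv y + uu y * vv x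
    pairwise x y = begin
      2 * (uv x * uv y)                                   ≡⟨ regroup (u x) (v x) (u y) (v y) ⟩
      2 * ((u x * v y) * (u y * v x))                     ≤⟨ 2*m*n≤m*m+n*n (u x * v y) (u y * v x) ⟩
      (u x * v y) * (u x * v y) + (u y * v x) * (u y * v x) ≡⟨ regroup² (u x) (v x) (u y) (v y) ⟩
      uu x * vv y + uu y * vv x                           ∎

  cauchy-schwarz₂ : (xs : List A) (ys : List B) (u v : A → B → ℕ) →
    ∑ xs (λ x → ∑ ys (λ y → u x y * v x y)) * ∑ xs (λ x → ∑ ys (λ y → u x y * v x y))
      ≤ ∑ xs (λ x → ∑ ys (λ y → u x y * u x y)) * ∑ xs (λ x → ∑ ys (λ y → v x y * v x y))
  cauchy-schwarz₂ xs ys u v =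
    subst₂ _≤_ (cong₂ _*_ (flatten _) (flatten _)) (cong₂ _*_ (flatten _) (flatten _))
      (cauchy-schwarz pairs (λ (x , y) → u x y) (λ (x , y) → v x y))
    where
    pairs = concatMap (λ x → map (x ,_) ys) xs
    flatten : (h : _ → _ → ℕ) → ∑ pairs (λ (x , y) → h x y) ≡ ∑ xs (λ x → ∑ ys (h x))
    flatten h = trans (∑-concatMap _ xs _) (∑-cong xs (λ x → ∑-map (x ,_) ys _))

  Matrix : ℕ → ℕ → Set
  Matrix p q = Fin p → Fin q → ℕ

  _·_ : Matrix p q → Matrix q r → Matrix p r
  _·_ {q = q} M N a c = ∑ (allFin q) (λ b → M a b * N b c)

  ‖_‖² : Matrix p q → ℕ
  ‖_‖² {p} {q} M = ∑ (allFin p) (λ a → ∑ (allFin q) (λ b → M a b * M a b))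

  trace : Matrix p p → ℕ
  trace {p} M = ∑ (allFin p) (λ a → M a a)

  trace-·²≤‖‖²*‖‖² : (M : Matrix p q) (N : Matrix q p) → trace (M · N) * trace (M · N) ≤ ‖ M ‖² * ‖ N ‖²
  trace-·²≤‖‖²*‖‖² {p} {q} M N =
    ≤-trans (cauchy-schwarz₂ (allFin p) (allFin q) M (λ a b → N b a))
      (≤-reflexive (cong (‖ M ‖² *_) (∑-comm (allFin p) (allFin q) (λ a b → N b a * N b a))))

  ‖·‖²≤‖‖²*‖‖² : (M : Matrix p q) (N : Matrix q r) → ‖ M · N ‖² ≤ ‖ M ‖² * ‖ N ‖²
  ‖·‖²≤‖‖²*‖‖² {p} {q} {r} M N = begin
    ‖ M · N ‖²                                       ≤⟨ ∑-mono (allFin p) (λ a → ∑-mono (allFin r) (λ c →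
                                                          cauchy-schwarz (allFin q) (M a) (λ b → N b c))) ⟩
    ∑ (allFin p) (λ a → ∑ (allFin r) (λ c → row a * column c)) ≡⟨ sym (∑-*-∑ (allFin p) (allFin r) row column) ⟩
    ‖ M ‖² * ∑ (allFin r) column                     ≡⟨ cong (‖ M ‖² *_) (∑-comm (allFin r) (allFin q) (λ c b → N b c * N b c)) ⟩
    ‖ M ‖² * ‖ N ‖²                                  ∎
    where
    open ≤-Reasoning
    row : Fin p → ℕ
    row a = ∑ (allFin q) (λ b → M a b * M a b)
    column : Fin r → ℕ
    column c = ∑ (allFin q) (λ b → N b c * N b c)

  Transversal : (k : ℕ) → (Fin k → ℕ) → Set
  Transversal k n = (i : Fin k) → Fin (n i)

  record Chain (k : ℕ) (n : Fin (suc (suc k)) → ℕ) : Set where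
    constructor chain
    field link : (i : Fin (suc k)) → Matrix (n (inject₁ i)) (n (fsuc i))
  open Chain

  head : {n : Fin (suc (suc k)) → ℕ} → Chain k n → Matrix (n fzero) (n (fsuc fzero))
  head W = link W fzero

  tail : {n : Fin (suc (suc (suc k))) → ℕ} → Chain (suc k) n → Chain k (n ∘ fsuc)
  tail W = chain (link W ∘ fsuc)

  pathWeight : {n : Fin (suc (suc k)) → ℕ} → Chain k n → Transversal (suc (suc k)) n → ℕ
  pathWeight {zero}  W f = head W (f fzero) (f (fsuc fzero))
  pathWeight {suc k} W f = head W (f fzero) (f (fsuc fzero)) * pathWeight (tail W) (f ∘ fsuc)

  ∏‖_‖² : {n : Fin (suc (suc k)) → ℕ} → Chain k n → ℕ
  ∏‖_‖² {k} W = prodℕ (map (λ i → ‖ link W i ‖²) (allFin (suc k)))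

  -- tr(W₀ W₁ ⋯ W_k Z), expanded as a sum over the transversals.
  cyclicTrace : {n : Fin (suc (suc k)) → ℕ} → Chain k n → Matrix (n (fromℕ (suc k))) (n fzero) → ℕ
  cyclicTrace {k} {n} W Z =
    ∑ (transversals (suc (suc k)) n) (λ f → Z (f (fromℕ (suc k))) (f fzero) * pathWeight W f)

  cyclicTrace-absorb : {n : Fin (suc (suc (suc k))) → ℕ} (W : Chain (suc k) n) (Z : Matrix (n (fromℕ (suc (suc k)))) (n fzero)) →
    cyclicTrace W Z ≡ cyclicTrace (tail W) (Z · head W)
  cyclicTrace-absorb {k} {n} W Z = begin
    cyclicTrace W Z
      ≡⟨ trans (∑-concatMap _ (allFin (n fzero)) _) (∑-cong (allFin (n fzero)) (λ a → ∑-map _ T _)) ⟩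
    ∑ (allFin (n fzero)) (λ a → ∑ T (λ f → Z (f last) a * (head W a (f fzero) * P f)))
      ≡⟨ ∑-comm (allFin (n fzero)) T _ ⟩
    ∑ T (λ f → ∑ (allFin (n fzero)) (λ a → Z (f last) a * (head W a (f fzero) * P f)))
      ≡⟨ ∑-cong T (λ f → ∑-cong (allFin (n fzero)) (λ a → sym (*-assoc (Z (f last) a) _ (P f)))) ⟩
    ∑ T (λ f → ∑ (allFin (n fzero)) (λ a → Z (f last) a * head W a (f fzero) * P f))
      ≡⟨ ∑-cong T (λ f → ∑-*ʳ (P f) (allFin (n fzero)) _) ⟩
    cyclicTrace (tail W) (Z · head W) ∎
    where
    open ≡-Reasoning
    last = fromℕ (suc k)
    T = transversals (suc (suc k)) (n ∘ fsuc)
    P = pathWeight (tail W)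

  cyclicTrace²≤‖‖²*∏‖‖² : {n : Fin (suc (suc k)) → ℕ} (W : Chain k n) (Z : Matrix (n (fromℕ (suc k))) (n fzero)) →
    cyclicTrace W Z * cyclicTrace W Z ≤ ‖ Z ‖² * ∏‖ W ‖²
  cyclicTrace²≤‖‖²*∏‖‖² {zero} {n} W Z = begin
    cyclicTrace W Z * cyclicTrace W Z ≡⟨ cong₂ _*_ two-cycle two-cycle ⟩
    trace (Z · head W) * trace (Z · head W) ≤⟨ trace-·²≤‖‖²*‖‖² Z (head W) ⟩
    ‖ Z ‖² * ‖ head W ‖²              ≡⟨ cong (‖ Z ‖² *_) (sym (*-identityʳ _)) ⟩
    ‖ Z ‖² * ∏‖ W ‖²                  ∎
    where
    open ≤-Reasoning
    two-cycle : cyclicTrace W Z ≡ trace (Z · head W)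
    two-cycle = begin-equality
      cyclicTrace W Z
        ≡⟨ trans (∑-concatMap _ (allFin (n fzero)) _) (∑-cong (allFin (n fzero)) (λ a →
             trans (∑-map _ (transversals 1 (n ∘ fsuc)) _) (∑-concatMap _ (allFin (n (fsuc fzero))) _))) ⟩
      ∑ (allFin (n fzero)) (λ a → ∑ (allFin (n (fsuc fzero))) (λ b → Z b a * head W a b + 0))
        ≡⟨ ∑-cong (allFin (n fzero)) (λ a → ∑-cong (allFin (n (fsuc fzero))) (λ b → +-identityʳ _)) ⟩
      ∑ (allFin (n fzero)) (λ a → ∑ (allFin (n (fsuc fzero))) (λ b → Z b a * head W a b))
        ≡⟨ ∑-comm (allFin (n fzero)) (allFin (n (fsuc fzero))) _ ⟩
      trace (Z · head W) ∎
  cyclicTrace²≤‖‖²*∏‖‖² {suc k} W Z = begin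
    cyclicTrace W Z * cyclicTrace W Z                  ≡⟨ cong₂ _*_ (cyclicTrace-absorb W Z) (cyclicTrace-absorb W Z) ⟩
    cyclicTrace (tail W) Z′ * cyclicTrace (tail W) Z′  ≤⟨ cyclicTrace²≤‖‖²*∏‖‖² (tail W) Z′ ⟩
    ‖ Z′ ‖² * ∏‖ tail W ‖²                             ≤⟨ *-monoˡ-≤ (∏‖ tail W ‖²) (‖·‖²≤‖‖²*‖‖² Z (head W)) ⟩
    ‖ Z ‖² * ‖ head W ‖² * ∏‖ tail W ‖²                ≡⟨ *-assoc ‖ Z ‖² _ _ ⟩
    ‖ Z ‖² * (‖ head W ‖² * ∏‖ tail W ‖²)              ≡⟨ cong (λ ws → ‖ Z ‖² * (‖ head W ‖² * prodℕ ws)) (map-∘ {g = λ i → ‖ link W i ‖²} {f = fsuc} (allFin (suc k))) ⟩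
    ‖ Z ‖² * ∏‖ W ‖²                                   ∎
    where
    open ≤-Reasoning
    Z′ = Z · head W

  indicator : Bool → ℕ
  indicator b = if b then 1 else 0

  indicator-idem : ∀ b → indicator b * indicator b ≡ indicator b
  indicator-idem true  = refl
  indicator-idem false = refl

  adjacency : {n : Fin k → ℕ} → Graph k n → (i j : Fin k) → Matrix (n i) (n j)
  adjacency G i j a b = indicator (adj G (i , a) (j , b))

  ‖adjacency‖²≡edges : {n : Fin k → ℕ} (G : Graph k n) (i j : Fin k) → ‖ adjacency G i j ‖² ≡ edges G i j
  ‖adjacency‖²≡edges {n = n} G i j =
    ∑-cong (allFin (n i)) (λ a → ∑-cong (allFin (n j)) (λ b → indicator-idem (adj G (i , a) (j , b))))

  allB-allFin : (P : Fin k → Bool) → allB P (allFin k) ≡ true → ∀ i → P i ≡ true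
  allB-allFin {suc k} P all fzero    = ∧-conicalˡ _ _ all
  allB-allFin {suc k} P all (fsuc i) =
    allB-allFin (P ∘ fsuc) (trans (sym (allB-map (allFin k))) (∧-conicalʳ _ _ all)) i
    where
    allB-map : (xs : List (Fin k)) → allB P (map fsuc xs) ≡ allB (P ∘ fsuc) xs
    allB-map []       = refl
    allB-map (x ∷ xs) = cong (P (fsuc x) ∧_) (allB-map xs)

  clique⇒adj : {n : Fin k → ℕ} (G : Graph k n) (f : Transversal k n) → isCliqueB G f ≡ true →
    ∀ i j → i ≢ j → adj G (i , f i) (j , f j) ≡ true
  clique⇒adj G f clique i j i≢j with i ≟ j | allB-allFin _ (allB-allFin _ clique i) j
  ... | yes i≡j | _       = ⊥-elim (i≢j i≡j)
  ... | no _    | adjacent = adjacent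

  length-filter≤∑ : {ℓ : Level} {P : Pred A ℓ} (P? : Decidable P) (w : A → ℕ) → (∀ x → P x → 1 ≤ w x) →
    (xs : List A) → length (filter P? xs) ≤ ∑ xs w
  length-filter≤∑ P? w P⇒1≤w []       = z≤n
  length-filter≤∑ P? w P⇒1≤w (x ∷ xs) with P? x
  ... | yes Px = +-mono-≤ (P⇒1≤w x Px) (length-filter≤∑ P? w P⇒1≤w xs)
  ... | no _   = ≤-trans (length-filter≤∑ P? w P⇒1≤w xs) (m≤n+m _ (w x))

  inject₁≢suc : (i : Fin m) → inject₁ i ≢ fsuc i
  inject₁≢suc fzero    ()
  inject₁≢suc (fsuc i) eq = inject₁≢suc i (suc-injective eq)

  1≤pathWeight : {n : Fin (suc (suc k)) → ℕ} (W : Chain k n) (f : Transversal (suc (suc k)) n) →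
    (∀ i → 1 ≤ link W i (f (inject₁ i)) (f (fsuc i))) → 1 ≤ pathWeight W f
  1≤pathWeight {zero}  W f positive = positive fzero
  1≤pathWeight {suc k} W f positive = *-mono-≤ (positive fzero) (1≤pathWeight (tail W) (f ∘ fsuc) (positive ∘ fsuc))

  adjacencyChain : {n : Fin (suc (suc k)) → ℕ} → Graph (suc (suc k)) n → Chain k n
  adjacencyChain G = chain (λ i → adjacency G (inject₁ i) (fsuc i))

  transversalCliques≤cyclicTrace : {n : Fin (suc (suc k)) → ℕ} (G : Graph (suc (suc k)) n) →
    transversalCliques G ≤ cyclicTrace (adjacencyChain G) (adjacency G (fromℕ (suc k)) fzero)
  transversalCliques≤cyclicTrace {k} {n} G = length-filter≤∑ _ _ closed-walk (transversals (suc (suc k)) n)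
    where
    1≤indicator : ∀ {b} → b ≡ true → 1 ≤ indicator b
    1≤indicator refl = s≤s z≤n
    closed-walk : ∀ f → isCliqueB G f ≡ true → 1 ≤ _
    closed-walk f clique = *-mono-≤ {1} {_} {1}
      (1≤indicator (clique⇒adj G f clique (fromℕ (suc k)) fzero λ ()))
      (1≤pathWeight (adjacencyChain G) f (λ i → 1≤indicator (clique⇒adj G f clique (inject₁ i) (fsuc i) (inject₁≢suc i))))

  toℕ-next : (i : Fin (suc m)) → toℕ (next i) ≡ suc (toℕ i) % suc m
  toℕ-next i = toℕ-fromℕ< _

  next-inject₁ : (i : Fin m) → next (inject₁ i) ≡ fsuc i
  next-inject₁ {m} i = toℕ-injective (begin
    toℕ (next (inject₁ i))      ≡⟨ toℕ-next (inject₁ i) ⟩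
    suc (toℕ (inject₁ i)) % suc m ≡⟨ cong (λ t → suc t % suc m) (toℕ-inject₁ i) ⟩
    suc (toℕ i) % suc m          ≡⟨ m<n⇒m%n≡m (s≤s (toℕ<n i)) ⟩
    suc (toℕ i)                  ∎)
    where open ≡-Reasoning

  next-fromℕ : next (fromℕ m) ≡ fzero
  next-fromℕ {m} = toℕ-injective (begin
    toℕ (next (fromℕ m))         ≡⟨ toℕ-next (fromℕ m) ⟩
    suc (toℕ (fromℕ m)) % suc m  ≡⟨ cong (λ t → suc t % suc m) (toℕ-fromℕ m) ⟩
    suc m % suc m                ≡⟨ n%n≡0 (suc m) ⟩
    0                            ∎)
    where open ≡-Reasoning

  inject₁-or-fromℕ : (i : Fin (suc m)) → ∃ (λ j → inject₁ j ≡ i) ⊎ fromℕ m ≡ i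
  inject₁-or-fromℕ {zero}  fzero    = inj₂ refl
  inject₁-or-fromℕ {suc m} fzero    = inj₁ (fzero , refl)
  inject₁-or-fromℕ {suc m} (fsuc i) with inject₁-or-fromℕ i
  ... | inj₁ (j , refl) = inj₁ (fsuc j , refl)
  ... | inj₂ refl       = inj₂ refl

  i≢next : (i : Fin (suc (suc k))) → i ≢ next i
  i≢next i with inject₁-or-fromℕ i
  ... | inj₁ (j , refl) = λ j≡next → inject₁≢suc j (trans j≡next (next-inject₁ j))
  ... | inj₂ refl       = λ last≡next → last≢fzero (trans last≡next next-fromℕ)
    where
    last≢fzero : fromℕ (suc _) ≢ fzero
    last≢fzero ()

  prodℕ-allFin-last : (g : Fin (suc m) → ℕ) →
    prodℕ (map g (allFin (suc m))) ≡ prodℕ (map (g ∘ inject₁) (allFin m)) * g (fromℕ m)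
  prodℕ-allFin-last {zero}  g = *-comm (g fzero) 1
  prodℕ-allFin-last {suc m} g = begin
    g fzero * prodℕ (map g (map fsuc (allFin (suc m))))
      ≡⟨ cong (λ gs → g fzero * prodℕ gs) (sym (map-∘ {g = g} {f = fsuc} (allFin (suc m)))) ⟩
    g fzero * prodℕ (map (g ∘ fsuc) (allFin (suc m)))
      ≡⟨ cong (g fzero *_) (prodℕ-allFin-last (g ∘ fsuc)) ⟩
    g fzero * (prodℕ (map (g ∘ fsuc ∘ inject₁) (allFin m)) * g (fromℕ (suc m)))
      ≡⟨ sym (*-assoc (g fzero) _ _) ⟩
    g fzero * prodℕ (map (g ∘ fsuc ∘ inject₁) (allFin m)) * g (fromℕ (suc m))
      ≡⟨ cong (λ gs → g fzero * prodℕ gs * g (fromℕ (suc m))) (map-∘ {g = g ∘ inject₁} {f = fsuc} (allFin m)) ⟩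
    prodℕ (map (g ∘ inject₁) (allFin (suc m))) * g (fromℕ (suc m)) ∎
    where open ≡-Reasoning

  prodℕ-cycle : (g : Fin (suc m) → Fin (suc m) → ℕ) →
    prodℕ (map (λ i → g i (next i)) (allFin (suc m)))
      ≡ prodℕ (map (λ i → g (inject₁ i) (fsuc i)) (allFin m)) * g (fromℕ m) fzero
  prodℕ-cycle g = trans (prodℕ-allFin-last (λ i → g i (next i)))
    (cong₂ _*_ (cong prodℕ (map-cong (λ i → cong (g (inject₁ i)) (next-inject₁ i)) (allFin _)))
               (cong (g (fromℕ _)) next-fromℕ))

  prodℕ-next : (n : Fin (suc m) → ℕ) → prodℕ (map (n ∘ next) (allFin (suc m))) ≡ prodℕ (map n (allFin (suc m)))
  prodℕ-next {m} n = begin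
    prodℕ (map (n ∘ next) (allFin (suc m)))          ≡⟨ prodℕ-cycle (λ _ → n) ⟩
    prodℕ (map (n ∘ fsuc) (allFin m)) * n fzero       ≡⟨ *-comm _ (n fzero) ⟩
    n fzero * prodℕ (map (n ∘ fsuc) (allFin m))       ≡⟨ cong (λ ns → n fzero * prodℕ ns) (map-∘ {g = n} {f = fsuc} (allFin m)) ⟩
    prodℕ (map n (allFin (suc m)))                    ∎
    where open ≡-Reasoning

  transversalCliques²≤∏edges : {n : Fin (suc (suc k)) → ℕ} (G : Graph (suc (suc k)) n) →
    transversalCliques G * transversalCliques G ≤ prodℕ (map (λ i → edges G i (next i)) (allFin (suc (suc k))))
  transversalCliques²≤∏edges {k} G = begin
    transversalCliques G * transversalCliques G   ≤⟨ *-mono-≤ cliques≤trace cliques≤trace ⟩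
    cyclicTrace W Z * cyclicTrace W Z             ≤⟨ cyclicTrace²≤‖‖²*∏‖‖² W Z ⟩
    ‖ Z ‖² * ∏‖ W ‖²                              ≡⟨ *-comm ‖ Z ‖² _ ⟩
    ∏‖ W ‖² * ‖ Z ‖²                              ≡⟨ cong₂ _*_ (cong prodℕ (map-cong (λ i → ‖adjacency‖²≡edges G (inject₁ i) (fsuc i)) (allFin (suc k))))
                                                               (‖adjacency‖²≡edges G (fromℕ (suc k)) fzero) ⟩
    prodℕ (map (λ i → edges G (inject₁ i) (fsuc i)) (allFin (suc k))) * edges G (fromℕ (suc k)) fzero
                                                  ≡⟨ sym (prodℕ-cycle (edges G)) ⟩
    prodℕ (map (λ i → edges G i (next i)) (allFin (suc (suc k)))) ∎
    where
    open ≤-Reasoning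
    W = adjacencyChain G
    Z = adjacency G (fromℕ (suc k)) fzero
    cliques≤trace = transversalCliques≤cyclicTrace G

open Counting using (i≢next; prodℕ-next; transversalCliques²≤∏edges)

open import Data.Rational using (ℚ; 0ℚ; _*_; _-_) renaming (_≤_ to _≤ℚ_; _<_ to _<ℚ_)

import Data.Nat as ℕ
import Data.Integer as ℤ
import Data.Integer.Properties as ℤ
open import Data.Rational using (mkℚ; _/_; nonNegative; *≤*)
import Data.Rational.Properties as ℚ
open import Data.Nat.Coprimality using (1-coprimeTo) renaming (sym to coprime-sym)
open import Algebra.Bundles using (CommutativeMonoid)
open import Algebra.Properties.CommutativeSemigroup
  (CommutativeMonoid.commutativeSemigroup ℚ.*-1-commutativeMonoid) using (interchange)

toℚ≡mkℚ : ∀ m → toℚ m ≡ mkℚ (ℤ.+ m) 0 (coprime-sym (1-coprimeTo m))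
toℚ≡mkℚ m = ℚ.normalize-coprime (coprime-sym (1-coprimeTo m))

toℚ-* : ∀ a b → toℚ (a ℕ.* b) ≡ toℚ a * toℚ b
toℚ-* a b rewrite toℚ≡mkℚ a | toℚ≡mkℚ b = cong (_/ 1) (ℤ.pos-* a b)

toℚ-mono-≤ : ∀ {a b} → a ≤ b → toℚ a ≤ℚ toℚ b
toℚ-mono-≤ {a} {b} a≤b rewrite toℚ≡mkℚ a | toℚ≡mkℚ b =
  *≤* (subst₂ ℤ._≤_ (sym (ℤ.*-identityʳ (ℤ.+ a))) (sym (ℤ.*-identityʳ (ℤ.+ b))) (ℤ.+≤+ a≤b))

toℚ-prodℕ : {A : Set} (xs : List A) (g : A → ℕ) → toℚ (prodℕ (map g xs)) ≡ prodℚ (map (λ x → toℚ (g x)) xs)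
toℚ-prodℕ []       g = refl
toℚ-prodℕ (x ∷ xs) g = trans (toℚ-* (g x) _) (cong (toℚ (g x) *_) (toℚ-prodℕ xs g))

prodℚ-*-* : {A : Set} (xs : List A) (a b c : A → ℚ) →
  prodℚ (map (λ x → a x * (b x * c x)) xs) ≡ prodℚ (map a xs) * (prodℚ (map b xs) * prodℚ (map c xs))
prodℚ-*-* []       a b c = refl
prodℚ-*-* (x ∷ xs) a b c = begin
  a x * (b x * c x) * prodℚ (map (λ x → a x * (b x * c x)) xs) ≡⟨ cong (a x * (b x * c x) *_) (prodℚ-*-* xs a b c) ⟩
  a x * (b x * c x) * (∏a * (∏b * ∏c))                        ≡⟨ interchange (a x) (b x * c x) ∏a (∏b * ∏c) ⟩
  a x * ∏a * (b x * c x * (∏b * ∏c))                          ≡⟨ cong (a x * ∏a *_) (interchange (b x) (c x) ∏b ∏c) ⟩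
  a x * ∏a * (b x * ∏b * (c x * ∏c))                          ∎
  where
  open ≡-Reasoning
  ∏a = prodℚ (map a xs)
  ∏b = prodℚ (map b xs)
  ∏c = prodℚ (map c xs)

≤0-or-square≤ : (t s B : ℚ) → 0ℚ ≤ℚ s → t * t ≤ℚ B → (t - s ≤ℚ 0ℚ) ⊎ ((t - s) * (t - s) ≤ℚ B)
≤0-or-square≤ t s B 0≤s t²≤B with t - s ℚ.≤? 0ℚ
... | yes t-s≤0 = inj₁ t-s≤0
... | no  t-s≰0 = inj₂ (begin
  (t - s) * (t - s) ≤⟨ ℚ.*-monoʳ-≤-nonNeg (t - s) {{nonNegative 0≤t-s}} t-s≤t ⟩
  t * (t - s)       ≤⟨ ℚ.*-monoˡ-≤-nonNeg t {{nonNegative (ℚ.≤-trans 0≤t-s t-s≤t)}} t-s≤t ⟩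
  t * t             ≤⟨ t²≤B ⟩
  B                 ∎)
  where
  open ℚ.≤-Reasoning
  0≤t-s : 0ℚ ≤ℚ t - s
  0≤t-s = ℚ.<⇒≤ (ℚ.≰⇒> t-s≰0)
  t-s≤t : t - s ≤ℚ t
  t-s≤t = ℚ.≤-trans (ℚ.+-monoʳ-≤ t (ℚ.neg-antimono-≤ 0≤s)) (ℚ.≤-reflexive (ℚ.+-identityʳ t))

0≤*toℚ : ∀ {ε} → 0ℚ <ℚ ε → ∀ m → 0ℚ ≤ℚ ε * toℚ m
0≤*toℚ {ε} 0<ε m = ℚ.nonNegative⁻¹ _
  {{ℚ.nonNeg*nonNeg⇒nonNeg ε {{nonNegative (ℚ.<⇒≤ 0<ε)}} (toℚ m) {{nonNegative (toℚ-mono-≤ {0} {m} z≤n)}}}}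

transversalCliques²≤∏densities : ∀ {k} {n : Fin (suc (suc k)) → ℕ} (G : Graph (suc (suc k)) n)
  (d : Fin (suc (suc k)) → Fin (suc (suc k)) → ℚ) →
  (∀ i j → i ≢ j → toℚ (edges G i j) ≡ d i j * (toℚ (n i) * toℚ (n j))) →
  toℚ (transversalCliques G) * toℚ (transversalCliques G)
    ≤ℚ prodℚ (map (λ i → d i (next i)) (allFin (suc (suc k))))
       * (toℚ (prodℕ (map n (allFin (suc (suc k))))) * toℚ (prodℕ (map n (allFin (suc (suc k))))))
transversalCliques²≤∏densities {k} {n} G d densities = begin
  toℚ T * toℚ T                                                     ≡⟨ sym (toℚ-* T T) ⟩
  toℚ (T ℕ.* T)                                                      ≤⟨ toℚ-mono-≤ (transversalCliques²≤∏edges G) ⟩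
  toℚ (prodℕ (map (λ i → edges G i (next i)) V))                    ≡⟨ toℚ-prodℕ V (λ i → edges G i (next i)) ⟩
  prodℚ (map (λ i → toℚ (edges G i (next i))) V)                    ≡⟨ cong prodℚ (map-cong (λ i → densities i (next i) (i≢next i)) V) ⟩
  prodℚ (map (λ i → d i (next i) * (toℚ (n i) * toℚ (n (next i)))) V) ≡⟨ prodℚ-*-* V (λ i → d i (next i)) (λ i → toℚ (n i)) (λ i → toℚ (n (next i))) ⟩
  D * (prodℚ (map (λ i → toℚ (n i)) V) * prodℚ (map (λ i → toℚ (n (next i))) V))
                                                                     ≡⟨ cong (D *_) (cong₂ _*_ (sym (toℚ-prodℕ V n))
                                                                          (trans (sym (toℚ-prodℕ V (λ i → n (next i)))) (cong toℚ (prodℕ-next n)))) ⟩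
  D * (toℚ (prodℕ (map n V)) * toℚ (prodℕ (map n V)))               ∎
  where
  open ℚ.≤-Reasoning
  V = allFin (suc (suc k))
  T = transversalCliques G
  D = prodℚ (map (λ i → d i (next i)) V)

lemma2p2 : (k : ℕ) → 4 ≤ k → (d : Fin k → Fin k → ℚ) → (ε : ℚ) → 0ℚ <ℚ ε →
    ∃ λ (N : ℕ) → (n : Fin k → ℕ) → (∀ i → 1 ≤ n i) → (∀ i → N ≤ n i) →
    (G : Graph k n) →
    (∀ i j → i ≢ j → toℚ (edges G i j) ≡ d i j * (toℚ (n i) * toℚ (n j))) →
    (toℚ (transversalCliques G) - ε * toℚ (prodℕ (map n (allFin k))) ≤ℚ 0ℚ)
    ⊎ ((toℚ (transversalCliques G) - ε * toℚ (prodℕ (map n (allFin k))))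
    * (toℚ (transversalCliques G) - ε * toℚ (prodℕ (map n (allFin k))))
    ≤ℚ prodℚ (map (λ i → d i (next i)) (allFin k))
    * (toℚ (prodℕ (map n (allFin k))) * toℚ (prodℕ (map n (allFin k)))))
lemma2p2 zero          ()
lemma2p2 (suc zero)    (s≤s ())
lemma2p2 (suc (suc k)) _ d ε 0<ε = 0 , λ n _ _ G densities →
  ≤0-or-square≤ (toℚ (transversalCliques G)) (ε * toℚ (prodℕ (map n (allFin (suc (suc k))))))
    _ (0≤*toℚ 0<ε (prodℕ (map n (allFin (suc (suc k)))))) (transversalCliques²≤∏densities G d densities)
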